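{- Let $P\colon\mathcal C^{op}\to\mathbf{InfSL}$ be an elementary existential doctrine. Then $\mathcal A_P$, with tensor product given on objects by $\times$ and on morphisms $f\in P(A\times B)$, $g\in P(C\times D)$ by $f\otimes g=P_{\langle\pi_1,\pi_3\rangle}(f)\wedge P_{\langle\pi_2,\pi_4\rangle}(g)\in P(A\times C\times B\times D)$, and with associator, unitors and symmetry given by the images under $\Gamma_P$ of the corresponding isomorphisms of $\mathcal C$, is a symmetric monoidal category.
   Context: $\mathcal C$: cartesian category (chosen products $\times$, projections $\pi_i$, pairing, terminal $I$, diagonals $\Delta_A$). $\mathbf{InfSL}$: meet-semilattices with top and finite-meet-preserving maps; $P_f=P(f)$. Elementary existential doctrine: there are $\delta_A\in P(A\times A)$ such that for $e=\mathrm{id}_X\times\Delta_A$, $P_e$ has left adjoint $\exists_e(\alpha)=P_{\langle\pi_1,\pi_2\rangle}(\alpha)\wedge P_{\langle\pi_2,\pi_3\rangle}(\delta_A)$; for each product projection $\pi$, $P_\pi$ has a left adjoint $\exists_\pi$ satisfying Beck–Chevalley (for any projection $\pi\colon X\times A\to A$ and pullback square $\pi f'=f\pi'$, $\exists_{\pi'}P_{f'}=P_f\exists_\pi$) and Frobenius reciprocity $\exists_\pi(P_\pi\alpha\wedge\beta)=\alpha\wedge\exists_\pi\beta$. $\mathcal A_P$: objects of $\mathcal C$, $\mathrm{Hom}(X,Y)=P(X\times Y)$, identity $\delta_X$, composite $f;g=\exists_{\langle\pi_1,\pi_3\rangle}(P_{\langle\pi_1,\pi_2\rangle}(f)\wedge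 P_{\langle\pi_2,\pi_3\rangle}(g))$ for $f\in P(X\times Y)$, $g\in P(Y\times Z)$. The graph functor $\Gamma_P\colon\mathcal C\to\mathcal A_P$ is the identity on objects and sends $f\colon X\to Y$ to $P_{f\times\mathrm{id}_Y}(\delta_Y)$. -}

module Defs where

open import Level using (Level; _⊔_) renaming (suc to lsuc)
open import Relation.Binary.PropositionalEquality using (_≡_)
open import Relation.Binary.Lattice.Structures using (IsBoundedMeetSemilattice)
open import Function.Bundles using (_⇔_)
open import Data.Product using (Σ) renaming (_×_ to _×ₚ_)

record CartesianCategory (o h : Level) : Set (lsuc (o ⊔ h)) where
  infixr 9 _∘_
  infixr 7 _×_
  infixr 8 _⁂_
  field
    Obj : Set o
    _⇒_ : Obj → Obj → Set h
    id  : ∀ {A} → A ⇒ A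
    _∘_ : ∀ {A B C} → B ⇒ C → A ⇒ B → A ⇒ C
    assoc     : ∀ {A B C D} {f : A ⇒ B} {g : B ⇒ C} {k : C ⇒ D} →
                (k ∘ g) ∘ f ≡ k ∘ (g ∘ f)
    identityˡ : ∀ {A B} {f : A ⇒ B} → id ∘ f ≡ f
    identityʳ : ∀ {A B} {f : A ⇒ B} → f ∘ id ≡ f
    I        : Obj
    !        : ∀ {A} → A ⇒ I
    !-unique : ∀ {A} (f : A ⇒ I) → f ≡ !
    _×_      : Obj → Obj → Obj
    π₁       : ∀ {A B} → (A × B) ⇒ A
    π₂       : ∀ {A B} → (A × B) ⇒ B
    ⟨_,_⟩    : ∀ {X A B} → X ⇒ A → X ⇒ B → X ⇒ (A × B)
    project₁ : ∀ {X A B} {f : X ⇒ A} {g : X ⇒ B} → π₁ ∘ ⟨ f , g ⟩ ≡ f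
    project₂ : ∀ {X A B} {f : X ⇒ A} {g : X ⇒ B} → π₂ ∘ ⟨ f , g ⟩ ≡ g
    unique   : ∀ {X A B} {k : X ⇒ (A × B)} → ⟨ π₁ ∘ k , π₂ ∘ k ⟩ ≡ k

  Δ : ∀ {A} → A ⇒ (A × A)
  Δ = ⟨ id , id ⟩

  _⁂_ : ∀ {A B C D} → A ⇒ B → C ⇒ D → (A × C) ⇒ (B × D)
  f ⁂ g = ⟨ f ∘ π₁ , g ∘ π₂ ⟩

  assocC : ∀ {A B C} → ((A × B) × C) ⇒ (A × (B × C))
  assocC = ⟨ π₁ ∘ π₁ , ⟨ π₂ ∘ π₁ , π₂ ⟩ ⟩

  unitorˡC : ∀ {A} → (I × A) ⇒ A
  unitorˡC = π₂

  unitorʳC : ∀ {A} → (A × I) ⇒ A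
  unitorʳC = π₁

  swapC : ∀ {A B} → (A × B) ⇒ (B × A)
  swapC = ⟨ π₂ , π₁ ⟩

record ElementaryExistentialDoctrine {o h} (C : CartesianCategory o h) (p q : Level)
       : Set (o ⊔ h ⊔ lsuc (p ⊔ q)) where
  open CartesianCategory C
  infixr 6 _∧_
  infix 4 _≤_
  field
    PObj : Obj → Set p
    _≤_  : ∀ {A} → PObj A → PObj A → Set q
    _∧_  : ∀ {A} → PObj A → PObj A → PObj A
    ⊤    : ∀ {A} → PObj A
    isInfSL : ∀ {A} → IsBoundedMeetSemilattice (_≡_ {A = PObj A}) _≤_ _∧_ ⊤
    P₍_₎   : ∀ {A B} → A ⇒ B → PObj B → PObj A
    P-⊤    : ∀ {A B} (f : A ⇒ B) → P₍ f ₎ ⊤ ≡ ⊤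
    P-∧    : ∀ {A B} (f : A ⇒ B) (a b : PObj B) → P₍ f ₎ (a ∧ b) ≡ P₍ f ₎ a ∧ P₍ f ₎ b
    P-id   : ∀ {A} (a : PObj A) → P₍ id ₎ a ≡ a
    P-∘    : ∀ {A B C} (f : A ⇒ B) (g : B ⇒ C) (a : PObj C) →
             P₍ g ∘ f ₎ a ≡ P₍ f ₎ (P₍ g ₎ a)

    -- elementary structure: for e = id_X × Δ_A : X × A → X × (A × A),
    -- ∃_e α = P_⟨π₁,π₂⟩ α ∧ P_⟨π₂,π₃⟩ δ_A is left adjoint to P_e.
    δ     : ∀ {A} → PObj (A × A)
    δ-adj : ∀ {X A} (α : PObj (X × A)) (β : PObj (X × (A × A))) →
            (P₍ ⟨ π₁ , π₁ ∘ π₂ ⟩ ₎ α ∧ P₍ ⟨ π₁ ∘ π₂ , π₂ ∘ π₂ ⟩ ₎ δ ≤ β)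
              ⇔ (α ≤ P₍ id ⁂ Δ ₎ β)

    ∃₁     : ∀ {A B} → PObj (A × B) → PObj A
    ∃₁-adj : ∀ {A B} (α : PObj (A × B)) (β : PObj A) →
             (∃₁ α ≤ β) ⇔ (α ≤ P₍ π₁ ₎ β)
    ∃₁-BC  : ∀ {A A′ B} (f : A′ ⇒ A) (α : PObj (A × B)) →
             ∃₁ (P₍ f ⁂ id ₎ α) ≡ P₍ f ₎ (∃₁ α)
    ∃₁-Frob : ∀ {A B} (a : PObj A) (β : PObj (A × B)) →
             ∃₁ (P₍ π₁ ₎ a ∧ β) ≡ a ∧ ∃₁ β

    ∃₂     : ∀ {X A} → PObj (X × A) → PObj A
    ∃₂-adj : ∀ {X A} (α : PObj (X × A)) (β : PObj A) →
             (∃₂ α ≤ β) ⇔ (α ≤ P₍ π₂ ₎ β)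
    ∃₂-BC  : ∀ {X A B} (f : B ⇒ A) (α : PObj (X × A)) →
             ∃₂ (P₍ id ⁂ f ₎ α) ≡ P₍ f ₎ (∃₂ α)
    ∃₂-Frob : ∀ {X A} (a : PObj A) (β : PObj (X × A)) →
             ∃₂ (P₍ π₂ ₎ a ∧ β) ≡ a ∧ ∃₂ β

-- Symmetric monoidal categories (hom-sets with propositional equality),
-- composition written in diagrammatic order f ⨟ g (first f, then g).

IsIso : {o h : Level} {Obj : Set o} (Hom : Obj → Obj → Set h)
        (idm : ∀ {A} → Hom A A)
        (_⨟_ : ∀ {A B C} → Hom A B → Hom B C → Hom A C) →
        ∀ {A B} → Hom A B → Set h
IsIso Hom idm _⨟_ {A} {B} f = Σ (Hom B A) (λ g → (f ⨟ g ≡ idm) ×ₚ (g ⨟ f ≡ idm))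

record IsSymmetricMonoidalCategory
  {o h : Level} {Obj : Set o} (Hom : Obj → Obj → Set h)
  (idm : ∀ {A} → Hom A A)
  (_⨟_ : ∀ {A B C} → Hom A B → Hom B C → Hom A C)
  (_⊗₀_ : Obj → Obj → Obj)
  (_⊗₁_ : ∀ {A B C D} → Hom A B → Hom C D → Hom (A ⊗₀ C) (B ⊗₀ D))
  (unit : Obj)
  (α : ∀ {A B C} → Hom ((A ⊗₀ B) ⊗₀ C) (A ⊗₀ (B ⊗₀ C)))
  (λ′ : ∀ {A} → Hom (unit ⊗₀ A) A)
  (ρ : ∀ {A} → Hom (A ⊗₀ unit) A)
  (σ : ∀ {A B} → Hom (A ⊗₀ B) (B ⊗₀ A))
  : Set (o ⊔ h) where
  field
    ⨟-assoc : ∀ {A B C D} (f : Hom A B) (g : Hom B C) (k : Hom C D) →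
              (f ⨟ g) ⨟ k ≡ f ⨟ (g ⨟ k)
    ⨟-idˡ   : ∀ {A B} (f : Hom A B) → idm ⨟ f ≡ f
    ⨟-idʳ   : ∀ {A B} (f : Hom A B) → f ⨟ idm ≡ f
    ⊗-id    : ∀ {A B} → (idm {A} ⊗₁ idm {B}) ≡ idm
    ⊗-⨟     : ∀ {A₁ B₁ C₁ A₂ B₂ C₂}
              (f₁ : Hom A₁ B₁) (g₁ : Hom B₁ C₁) (f₂ : Hom A₂ B₂) (g₂ : Hom B₂ C₂) →
              ((f₁ ⨟ g₁) ⊗₁ (f₂ ⨟ g₂)) ≡ ((f₁ ⊗₁ f₂) ⨟ (g₁ ⊗₁ g₂))
    α-iso   : ∀ {A B C} → IsIso Hom idm _⨟_ (α {A} {B} {C})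
    λ-iso   : ∀ {A} → IsIso Hom idm _⨟_ (λ′ {A})
    ρ-iso   : ∀ {A} → IsIso Hom idm _⨟_ (ρ {A})
    σ-iso   : ∀ {A B} → IsIso Hom idm _⨟_ (σ {A} {B})
    α-nat   : ∀ {A A′ B B′ C C′} (f : Hom A A′) (g : Hom B B′) (k : Hom C C′) →
              (((f ⊗₁ g) ⊗₁ k) ⨟ α) ≡ (α ⨟ (f ⊗₁ (g ⊗₁ k)))
    λ-nat   : ∀ {A A′} (f : Hom A A′) → ((idm {unit} ⊗₁ f) ⨟ λ′) ≡ (λ′ ⨟ f)
    ρ-nat   : ∀ {A A′} (f : Hom A A′) → ((f ⊗₁ idm {unit}) ⨟ ρ) ≡ (ρ ⨟ f)
    σ-nat   : ∀ {A A′ B B′} (f : Hom A A′) (g : Hom B B′) →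
              ((f ⊗₁ g) ⨟ σ) ≡ (σ ⨟ (g ⊗₁ f))
    pentagon : ∀ {A B C D} →
      (((α {A} {B} {C} ⊗₁ idm {D}) ⨟ α) ⨟ (idm ⊗₁ α)) ≡ (α ⨟ α)
    triangle : ∀ {A B} →
      (α {A} {unit} {B} ⨟ (idm ⊗₁ λ′)) ≡ (ρ ⊗₁ idm)
    hexagon  : ∀ {A B C} →
      ((α {A} {B} {C} ⨟ σ) ⨟ α) ≡ (((σ ⊗₁ idm) ⨟ α) ⨟ (idm ⊗₁ σ))
    symmetry : ∀ {A B} → (σ {A} {B} ⨟ σ) ≡ idm

module AP {o h p q} (C : CartesianCategory o h) (P : ElementaryExistentialDoctrine C p q) where
  open CartesianCategory C public
  open ElementaryExistentialDoctrine P public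

  Hom : Obj → Obj → Set p
  Hom X Y = PObj (X × Y)

  idA : ∀ {X} → Hom X X
  idA = δ

  -- ∃ along ⟨π₁,π₃⟩ : X × (Y × Z) → X × Z, i.e. the product projection
  -- (X × Z) × Y → X × Z precomposed with the canonical iso
  -- X × (Y × Z) ≅ (X × Z) × Y (∃ along an iso φ is P along φ⁻¹).
  ∃₁₃ : ∀ {X Y Z} → PObj (X × (Y × Z)) → PObj (X × Z)
  ∃₁₃ γ = ∃₁ (P₍ ⟨ π₁ ∘ π₁ , ⟨ π₂ , π₂ ∘ π₁ ⟩ ⟩ ₎ γ)

  infixl 5 _⨟_
  _⨟_ : ∀ {X Y Z} → Hom X Y → Hom Y Z → Hom X Z
  f ⨟ g = ∃₁₃ (P₍ ⟨ π₁ , π₁ ∘ π₂ ⟩ ₎ f ∧ P₍ ⟨ π₁ ∘ π₂ , π₂ ∘ π₂ ⟩ ₎ g)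

  infixr 8 _⊗_
  _⊗_ : ∀ {A B C D} → Hom A B → Hom C D → Hom (A × C) (B × D)
  f ⊗ g = P₍ ⟨ π₁ ∘ π₁ , π₁ ∘ π₂ ⟩ ₎ f ∧ P₍ ⟨ π₂ ∘ π₁ , π₂ ∘ π₂ ⟩ ₎ g

  Γ : ∀ {X Y} → X ⇒ Y → Hom X Y
  Γ f = P₍ f ⁂ id ₎ δ

  αA : ∀ {A B C} → Hom ((A × B) × C) (A × (B × C))
  αA = Γ assocC

  λA : ∀ {A} → Hom (I × A) A
  λA = Γ unitorˡC

  ρA : ∀ {A} → Hom (A × I) A
  ρA = Γ unitorʳC

  σA : ∀ {A B} → Hom (A × B) (B × A)
  σA = Γ swapC

-- Read P(X × Y) as relations from X to Y, with ∧ and ∃ as conjunction and existential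
-- quantification and δ as equality. The adjunction defining δ makes equality the least
-- reflexive relation and lets it substitute equals for equals; this gives the unit laws and
-- δ ⊗ δ = δ. Beck–Chevalley and Frobenius bring both sides of associativity, and of the
-- interchange law for ⊗, to a double existential over a meet of reindexed relations, equal up
-- to exchanging the two quantifiers. Finally the graph functor Γ preserves identities,
-- composition and ⊗, and composing with the graph of an isomorphism is reindexing; so the
-- naturality squares become identities between reindexings, and the coherence axioms are
-- images of equations in C.

module Submission where

open import Level using (_⊔_)
open import Relation.Binary.PropositionalEquality using (_≡_; refl; sym; trans; cong; cong₂; module ≡-Reasoning)
open import Function.Bundles using (Equivalence)
open import Data.Product using (_,_)
open import Relation.Binary.Lattice.Bundles using (BoundedMeetSemilattice)
import Relation.Binary.Lattice.Properties.BoundedMeetSemilattice as BoundedMeetSemilatticeProperties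
import Relation.Binary.Lattice.Properties.MeetSemilattice as MeetSemilatticeProperties
import Algebra.Properties.CommutativeSemigroup as CommutativeSemigroupProperties
open import Algebra.Structures using (IsCommutativeBand)
open import Algebra.Bundles using (CommutativeSemigroup)
import Relation.Binary.Reasoning.PartialOrder as PartialOrderReasoning
open import Defs

-- Equations between composites of projections, pairings and opaque morphisms are proved
-- by comparing normal forms: η-long pairings of projection paths.
module CartesianSolver {o h} (C : CartesianCategory o h) where
  open CartesianCategory C

  infixr 7 _⊛_
  data Ty : Set o where
    ι   : Obj → Ty
    _⊛_ : Ty → Ty → Ty

  ⟦_⟧ : Ty → Obj
  ⟦ ι A ⟧   = A
  ⟦ A ⊛ B ⟧ = ⟦ A ⟧ × ⟦ B ⟧

  infixr 9 _∘T_
  data Tm : Ty → Ty → Set (o ⊔ h) where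
    var   : ∀ {A B} → ⟦ A ⟧ ⇒ ⟦ B ⟧ → Tm A B
    idT   : ∀ {A} → Tm A A
    _∘T_  : ∀ {A B D} → Tm B D → Tm A B → Tm A D
    p₁    : ∀ {A B} → Tm (A ⊛ B) A
    p₂    : ∀ {A B} → Tm (A ⊛ B) B
    ⟪_,_⟫ : ∀ {X A B} → Tm X A → Tm X B → Tm X (A ⊛ B)

  ⟦_⟧T : ∀ {A B} → Tm A B → ⟦ A ⟧ ⇒ ⟦ B ⟧
  ⟦ var f ⟧T     = f
  ⟦ idT ⟧T       = id
  ⟦ t ∘T s ⟧T    = ⟦ t ⟧T ∘ ⟦ s ⟧T
  ⟦ p₁ ⟧T        = π₁
  ⟦ p₂ ⟧T        = π₂
  ⟦ ⟪ t , s ⟫ ⟧T = ⟨ ⟦ t ⟧T , ⟦ s ⟧T ⟩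

  ⌜_⌝ : ∀ {A B} → A ⇒ B → Tm (ι A) (ι B)
  ⌜ f ⌝ = var f

  infixr 8 _⁂T_
  _⁂T_ : ∀ {A B D E} → Tm A B → Tm D E → Tm (A ⊛ D) (B ⊛ E)
  t ⁂T s = ⟪ t ∘T p₁ , s ∘T p₂ ⟫

  mutual
    data Ne (Γ : Ty) : Ty → Set (o ⊔ h) where
      inp  : Ne Γ Γ
      fstN : ∀ {A B} → Ne Γ (A ⊛ B) → Ne Γ A
      sndN : ∀ {A B} → Ne Γ (A ⊛ B) → Ne Γ B
      app  : ∀ {A B} → ⟦ A ⟧ ⇒ ⟦ B ⟧ → Nf Γ A → Ne Γ B

    data Nf (Γ : Ty) : Ty → Set (o ⊔ h) where
      neN   : ∀ {X} → Ne Γ (ι X) → Nf Γ (ι X)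
      pairN : ∀ {A B} → Nf Γ A → Nf Γ B → Nf Γ (A ⊛ B)

  mutual
    ⟦_⟧ne : ∀ {Γ A} → Ne Γ A → ⟦ Γ ⟧ ⇒ ⟦ A ⟧
    ⟦ inp ⟧ne     = id
    ⟦ fstN n ⟧ne  = π₁ ∘ ⟦ n ⟧ne
    ⟦ sndN n ⟧ne  = π₂ ∘ ⟦ n ⟧ne
    ⟦ app f n ⟧ne = f ∘ ⟦ n ⟧nf

    ⟦_⟧nf : ∀ {Γ A} → Nf Γ A → ⟦ Γ ⟧ ⇒ ⟦ A ⟧
    ⟦ neN n ⟧nf     = ⟦ n ⟧ne
    ⟦ pairN a b ⟧nf = ⟨ ⟦ a ⟧nf , ⟦ b ⟧nf ⟩

  η-expand : ∀ {Γ A} → Ne Γ A → Nf Γ A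
  η-expand {A = ι X}   n = neN n
  η-expand {A = A ⊛ B} n = pairN (η-expand (fstN n)) (η-expand (sndN n))

  eval : ∀ {Γ A B} → Tm A B → Nf Γ A → Nf Γ B
  eval (var f)   n           = η-expand (app f n)
  eval idT       n           = n
  eval (t ∘T s)  n           = eval t (eval s n)
  eval p₁        (pairN a b) = a
  eval p₂        (pairN a b) = b
  eval ⟪ t , s ⟫ n           = pairN (eval t n) (eval s n)

  norm : ∀ {A B} → Tm A B → Nf A B
  norm t = eval t (η-expand inp)

  ⟨⟩∘ : ∀ {X Y A B} {f : Y ⇒ A} {g : Y ⇒ B} {k : X ⇒ Y} → ⟨ f , g ⟩ ∘ k ≡ ⟨ f ∘ k , g ∘ k ⟩
  ⟨⟩∘ {f = f} {g} {k} = begin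
    ⟨ f , g ⟩ ∘ k                               ≡⟨ unique ⟨
    ⟨ π₁ ∘ ⟨ f , g ⟩ ∘ k , π₂ ∘ ⟨ f , g ⟩ ∘ k ⟩ ≡⟨ cong₂ ⟨_,_⟩ (trans (sym assoc) (cong (_∘ k) project₁))
                                                              (trans (sym assoc) (cong (_∘ k) project₂)) ⟩
    ⟨ f ∘ k , g ∘ k ⟩                           ∎
    where open ≡-Reasoning

  η-expand-sound : ∀ {Γ A} (n : Ne Γ A) → ⟦ η-expand n ⟧nf ≡ ⟦ n ⟧ne
  η-expand-sound {A = ι X}   n = refl
  η-expand-sound {A = A ⊛ B} n =
    trans (cong₂ ⟨_,_⟩ (η-expand-sound (fstN n)) (η-expand-sound (sndN n))) unique

  eval-sound : ∀ {Γ A B} (t : Tm A B) (n : Nf Γ A) → ⟦ eval t n ⟧nf ≡ ⟦ t ⟧T ∘ ⟦ n ⟧nf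
  eval-sound {B = B} (var f) n = η-expand-sound {A = B} (app f n)
  eval-sound idT         n           = sym identityˡ
  eval-sound (t ∘T s)    n           =
    trans (eval-sound t (eval s n)) (trans (cong (⟦ t ⟧T ∘_) (eval-sound s n)) (sym assoc))
  eval-sound p₁          (pairN a b) = sym project₁
  eval-sound p₂          (pairN a b) = sym project₂
  eval-sound ⟪ t , s ⟫   n           = trans (cong₂ ⟨_,_⟩ (eval-sound t n) (eval-sound s n)) (sym ⟨⟩∘)

  norm-sound : ∀ {A B} (t : Tm A B) → ⟦ norm t ⟧nf ≡ ⟦ t ⟧T
  norm-sound {A} t =
    trans (eval-sound t (η-expand inp)) (trans (cong (⟦ t ⟧T ∘_) (η-expand-sound {Γ = A} inp)) identityʳ)

  solve : ∀ {A B} (t s : Tm A B) → ⟦ norm t ⟧nf ≡ ⟦ norm s ⟧nf → ⟦ t ⟧T ≡ ⟦ s ⟧T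
  solve t s eq = trans (sym (norm-sound t)) (trans eq (norm-sound s))

module CartesianMaps {o h} (C : CartesianCategory o h) where
  open CartesianCategory C
  open CartesianSolver C

  assocC⁻¹ : ∀ {A B D} → (A × (B × D)) ⇒ ((A × B) × D)
  assocC⁻¹ = ⟨ ⟨ π₁ , π₁ ∘ π₂ ⟩ , π₂ ∘ π₂ ⟩

  exchange : ∀ {A B D} → ((A × D) × B) ⇒ ((A × B) × D)
  exchange = ⟨ ⟨ π₁ ∘ π₁ , π₂ ⟩ , π₂ ∘ π₁ ⟩

  assocT : ∀ {A B D} → Tm ((A ⊛ B) ⊛ D) (A ⊛ (B ⊛ D))
  assocT = ⟪ p₁ ∘T p₁ , ⟪ p₂ ∘T p₁ , p₂ ⟫ ⟫

  assocT⁻¹ : ∀ {A B D} → Tm (A ⊛ (B ⊛ D)) ((A ⊛ B) ⊛ D)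
  assocT⁻¹ = ⟪ ⟪ p₁ , p₁ ∘T p₂ ⟫ , p₂ ∘T p₂ ⟫

  exchangeT : ∀ {A B D} → Tm ((A ⊛ D) ⊛ B) ((A ⊛ B) ⊛ D)
  exchangeT = ⟪ ⟪ p₁ ∘T p₁ , p₂ ⟫ , p₂ ∘T p₁ ⟫

  swapT : ∀ {A B} → Tm (A ⊛ B) (B ⊛ A)
  swapT = ⟪ p₂ , p₁ ⟫

  ΔT : ∀ {A} → Tm A (A ⊛ A)
  ΔT = ⟪ idT , idT ⟫

  ⋈₁T : ∀ {X Y Z} → Tm ((X ⊛ Z) ⊛ Y) (X ⊛ Y)
  ⋈₁T = ⟪ p₁ ∘T p₁ , p₂ ⟫

  ⋈₂T : ∀ {X Y Z} → Tm ((X ⊛ Z) ⊛ Y) (Y ⊛ Z)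
  ⋈₂T = ⟪ p₂ , p₂ ∘T p₁ ⟫

  ⊗₁T : ∀ {A₁ A₂ C₁ C₂} → Tm ((A₁ ⊛ A₂) ⊛ (C₁ ⊛ C₂)) (A₁ ⊛ C₁)
  ⊗₁T = ⟪ p₁ ∘T p₁ , p₁ ∘T p₂ ⟫

  ⊗₂T : ∀ {A₁ A₂ C₁ C₂} → Tm ((A₁ ⊛ A₂) ⊛ (C₁ ⊛ C₂)) (A₂ ⊛ C₂)
  ⊗₂T = ⟪ p₂ ∘T p₁ , p₂ ∘T p₂ ⟫

  assocC⁻¹∘assocC : ∀ {A B D} → assocC⁻¹ ∘ assocC ≡ id {(A × B) × D}
  assocC⁻¹∘assocC {A} {B} {D} =
    solve {A = (ι A ⊛ ι B) ⊛ ι D} {B = (ι A ⊛ ι B) ⊛ ι D} (assocT⁻¹ ∘T assocT) idT refl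

  assocC∘assocC⁻¹ : ∀ {A B D} → assocC ∘ assocC⁻¹ ≡ id {A × (B × D)}
  assocC∘assocC⁻¹ {A} {B} {D} =
    solve {A = ι A ⊛ (ι B ⊛ ι D)} {B = ι A ⊛ (ι B ⊛ ι D)} (assocT ∘T assocT⁻¹) idT refl

  swapC∘swapC : ∀ {A B} → swapC ∘ swapC ≡ id {A × B}
  swapC∘swapC {A} {B} = solve {A = ι A ⊛ ι B} {B = ι A ⊛ ι B} (swapT ∘T swapT) idT refl

  ⟨π₁,π₂⟩≡id : ∀ {A B} → ⟨ π₁ , π₂ ⟩ ≡ id {A × B}
  ⟨π₁,π₂⟩≡id {A} {B} = solve {A = ι A ⊛ ι B} {B = ι A ⊛ ι B} ⟪ p₁ , p₂ ⟫ idT refl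

  id⁂id≡id : ∀ {A B} → id ⁂ id ≡ id {A × B}
  id⁂id≡id {A} {B} = solve {A = ι A ⊛ ι B} {B = ι A ⊛ ι B} (idT ⁂T idT) idT refl

  ⟨!,id⟩∘π₂≡id : ∀ {A} → ⟨ ! , id ⟩ ∘ π₂ ≡ id {I × A}
  ⟨!,id⟩∘π₂≡id = trans ⟨⟩∘ (trans (cong₂ ⟨_,_⟩ (trans (!-unique _) (sym (!-unique π₁))) identityˡ) ⟨π₁,π₂⟩≡id)

  ⟨id,!⟩∘π₁≡id : ∀ {A} → ⟨ id , ! ⟩ ∘ π₁ ≡ id {A × I}
  ⟨id,!⟩∘π₁≡id = trans ⟨⟩∘ (trans (cong₂ ⟨_,_⟩ identityˡ (trans (!-unique _) (sym (!-unique π₂)))) ⟨π₁,π₂⟩≡id)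

module CategoryOfRelations {o h p q} (C : CartesianCategory o h) (P : ElementaryExistentialDoctrine C p q) where
  open AP C P
  open CartesianSolver C
  open CartesianMaps C
  open Equivalence

  module _ {A : Obj} where
    private
      PA : BoundedMeetSemilattice p p q
      PA = record { isBoundedMeetSemilattice = isInfSL {A} }

      ∧-commutativeSemigroup : CommutativeSemigroup p p
      ∧-commutativeSemigroup = record { isCommutativeSemigroup = IsCommutativeBand.isCommutativeSemigroup
        (MeetSemilatticeProperties.isAlgSemilattice (BoundedMeetSemilattice.meetSemilattice PA)) }

    open BoundedMeetSemilattice PA public
      using (poset; x∧y≤x; x∧y≤y; ∧-greatest; maximum)
      renaming (refl to ≤-refl; trans to ≤-trans; antisym to ≤-antisym; reflexive to ≤-reflexive)
    open BoundedMeetSemilatticeProperties PA public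
      using () renaming (identityˡ to ∧-identityˡ; identityʳ to ∧-identityʳ)
    open MeetSemilatticeProperties (BoundedMeetSemilattice.meetSemilattice PA) public
      using (∧-comm; ∧-assoc; y≤x⇒x∧y≈y)
    open CommutativeSemigroupProperties ∧-commutativeSemigroup public
      using () renaming (interchange to ∧-interchange)

  module ≤-Reasoning {A : Obj} = PartialOrderReasoning (poset {A})

  ⊤-unique : ∀ {A} {a : PObj A} → ⊤ ≤ a → a ≡ ⊤
  ⊤-unique ⊤≤a = ≤-antisym (maximum _) ⊤≤a

  P-monotone : ∀ {A B} (f : A ⇒ B) {a b : PObj B} → a ≤ b → P₍ f ₎ a ≤ P₍ f ₎ b
  P-monotone f {a} {b} a≤b = begin
    P₍ f ₎ a             ≡⟨ cong P₍ f ₎ (y≤x⇒x∧y≈y a≤b) ⟨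
    P₍ f ₎ (b ∧ a)       ≡⟨ P-∧ f b a ⟩
    P₍ f ₎ b ∧ P₍ f ₎ a  ≤⟨ x∧y≤x _ _ ⟩
    P₍ f ₎ b             ∎
    where open ≤-Reasoning

  P-cong : ∀ {A B} {f g : A ⇒ B} (a : PObj B) → f ≡ g → P₍ f ₎ a ≡ P₍ g ₎ a
  P-cong a f≡g = cong (λ f → P₍ f ₎ a) f≡g

  P-fuse : ∀ {A B D} {g : A ⇒ B} {f : B ⇒ D} {k : A ⇒ D} (a : PObj D) →
           f ∘ g ≡ k → P₍ g ₎ (P₍ f ₎ a) ≡ P₍ k ₎ a
  P-fuse {g = g} {f} a f∘g≡k = trans (sym (P-∘ g f a)) (P-cong a f∘g≡k)

  P-fuse₃ : ∀ {A B D E} {k : A ⇒ B} {g : B ⇒ D} {f : D ⇒ E} {m : A ⇒ E} (a : PObj E) →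
            (f ∘ g) ∘ k ≡ m → P₍ k ₎ (P₍ g ₎ (P₍ f ₎ a)) ≡ P₍ m ₎ a
  P-fuse₃ {k = k} a eq = trans (cong P₍ k ₎ (P-fuse a refl)) (P-fuse a eq)

  P-square : ∀ {A B B′ D} {g : A ⇒ B} {f : B ⇒ D} {g′ : A ⇒ B′} {f′ : B′ ⇒ D} (a : PObj D) →
             f ∘ g ≡ f′ ∘ g′ → P₍ g ₎ (P₍ f ₎ a) ≡ P₍ g′ ₎ (P₍ f′ ₎ a)
  P-square a eq = trans (P-fuse a eq) (sym (P-fuse a refl))

  ∃₁-unit : ∀ {A B} (α : PObj (A × B)) → α ≤ P₍ π₁ ₎ (∃₁ α)
  ∃₁-unit α = to (∃₁-adj α (∃₁ α)) ≤-refl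

  ∃₁-least : ∀ {A B} {α : PObj (A × B)} {β : PObj A} → α ≤ P₍ π₁ ₎ β → ∃₁ α ≤ β
  ∃₁-least {α = α} {β} = from (∃₁-adj α β)

  ∃₁-intro : ∀ {A B} (α : PObj (A × B)) (s : A ⇒ B) → P₍ ⟨ id , s ⟩ ₎ α ≤ ∃₁ α
  ∃₁-intro α s = begin
    P₍ ⟨ id , s ⟩ ₎ α                    ≤⟨ P-monotone ⟨ id , s ⟩ (∃₁-unit α) ⟩
    P₍ ⟨ id , s ⟩ ₎ (P₍ π₁ ₎ (∃₁ α))    ≡⟨ P-fuse _ project₁ ⟩
    P₍ id ₎ (∃₁ α)                       ≡⟨ P-id _ ⟩
    ∃₁ α                                 ∎
    where open ≤-Reasoning

  δ-reflexive : ∀ {Z A} (u : Z ⇒ A) → P₍ ⟨ u , u ⟩ ₎ δ ≡ ⊤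
  δ-reflexive {Z} {A} u = ⊤-unique (begin
    ⊤                                                               ≡⟨ P-⊤ ⟨ id , u ⟩ ⟨
    P₍ ⟨ id , u ⟩ ₎ ⊤                                               ≤⟨ P-monotone ⟨ id , u ⟩ ⊤≤δ ⟩
    P₍ ⟨ id , u ⟩ ₎ (P₍ id ⁂ Δ ₎ (P₍ ⟨ π₁ ∘ π₂ , π₂ ∘ π₂ ⟩ ₎ δ))  ≡⟨ P-fuse₃ δ (solve {A = ι Z} {B = ι A ⊛ ι A}
                                                                       ((⟪ p₁ ∘T p₂ , p₂ ∘T p₂ ⟫ ∘T (idT ⁂T ΔT)) ∘T ⟪ idT , ⌜ u ⌝ ⟫)
                                                                       ⟪ ⌜ u ⌝ , ⌜ u ⌝ ⟫ refl) ⟩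
    P₍ ⟨ u , u ⟩ ₎ δ                                                ∎)
    where
      open ≤-Reasoning
      ⊤≤δ : ⊤ ≤ P₍ id ⁂ Δ ₎ (P₍ ⟨ π₁ ∘ π₂ , π₂ ∘ π₂ ⟩ ₎ δ)
      ⊤≤δ = to (δ-adj {X = Z} {A} ⊤ _) (x∧y≤y _ _)

  -- The counit of δ-adj: φ(z , a) ∧ a = a′ ≤ φ(z , a′).
  δ-elim : ∀ {Z A} (φ : PObj (Z × A)) →
           P₍ ⟨ π₁ , π₁ ∘ π₂ ⟩ ₎ φ ∧ P₍ ⟨ π₁ ∘ π₂ , π₂ ∘ π₂ ⟩ ₎ δ ≤ P₍ ⟨ π₁ , π₂ ∘ π₂ ⟩ ₎ φ
  δ-elim {Z} {A} φ = begin
    P₍ ⟨ π₁ , π₁ ∘ π₂ ⟩ ₎ φ ∧ P₍ ⟨ π₁ ∘ π₂ , π₂ ∘ π₂ ⟩ ₎ δ                       ≡⟨ cong (λ ψ → P₍ _ ₎ ψ ∧ _) φ≡ ⟨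
    P₍ ⟨ π₁ , π₁ ∘ π₂ ⟩ ₎ (P₍ id ⁂ Δ ₎ φ′) ∧ P₍ ⟨ π₁ ∘ π₂ , π₂ ∘ π₂ ⟩ ₎ δ         ≤⟨ from (δ-adj _ φ′) ≤-refl ⟩
    φ′                                                                         ∎
    where
      open ≤-Reasoning
      φ′ : PObj (Z × (A × A))
      φ′ = P₍ ⟨ π₁ , π₂ ∘ π₂ ⟩ ₎ φ
      φ≡ : P₍ id ⁂ Δ ₎ φ′ ≡ φ
      φ≡ = trans (P-fuse φ (solve {A = ι Z ⊛ ι A} {B = ι Z ⊛ ι A}
                               (⟪ p₁ , p₂ ∘T p₂ ⟫ ∘T (idT ⁂T ΔT)) idT refl))
                 (P-id φ)

  δ-subst : ∀ {Z A} (u v : Z ⇒ A) (φ : PObj (Z × A)) {γ : PObj Z} →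
            γ ≤ P₍ ⟨ u , v ⟩ ₎ δ → γ ≤ P₍ ⟨ id , u ⟩ ₎ φ → γ ≤ P₍ ⟨ id , v ⟩ ₎ φ
  δ-subst {Z} {A} u v φ {γ} γ≤u≈v γ≤φu = begin
    γ                                                                  ≤⟨ ∧-greatest γ≤φu γ≤u≈v ⟩
    P₍ ⟨ id , u ⟩ ₎ φ ∧ P₍ ⟨ u , v ⟩ ₎ δ                               ≡⟨ cong₂ _∧_
      (P-fuse φ (solve {A = ι Z} {B = ι Z ⊛ ι A} (⟪ p₁ , p₁ ∘T p₂ ⟫ ∘T m) ⟪ idT , ⌜ u ⌝ ⟫ refl))
      (P-fuse δ (solve {A = ι Z} {B = ι A ⊛ ι A} (⟪ p₁ ∘T p₂ , p₂ ∘T p₂ ⟫ ∘T m) ⟪ ⌜ u ⌝ , ⌜ v ⌝ ⟫ refl)) ⟨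
    P₍ ⟦ m ⟧T ₎ (P₍ ⟨ π₁ , π₁ ∘ π₂ ⟩ ₎ φ) ∧ P₍ ⟦ m ⟧T ₎ (P₍ ⟨ π₁ ∘ π₂ , π₂ ∘ π₂ ⟩ ₎ δ) ≡⟨ P-∧ ⟦ m ⟧T _ _ ⟨
    P₍ ⟦ m ⟧T ₎ (P₍ ⟨ π₁ , π₁ ∘ π₂ ⟩ ₎ φ ∧ P₍ ⟨ π₁ ∘ π₂ , π₂ ∘ π₂ ⟩ ₎ δ) ≤⟨ P-monotone ⟦ m ⟧T (δ-elim φ) ⟩
    P₍ ⟦ m ⟧T ₎ (P₍ ⟨ π₁ , π₂ ∘ π₂ ⟩ ₎ φ)                               ≡⟨ P-fuse φ
      (solve {A = ι Z} {B = ι Z ⊛ ι A} (⟪ p₁ , p₂ ∘T p₂ ⟫ ∘T m) ⟪ idT , ⌜ v ⌝ ⟫ refl) ⟩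
    P₍ ⟨ id , v ⟩ ₎ φ                                                  ∎
    where
      open ≤-Reasoning
      m : Tm (ι Z) (ι Z ⊛ (ι A ⊛ ι A))
      m = ⟪ idT , ⟪ ⌜ u ⌝ , ⌜ v ⌝ ⟫ ⟫

  δ-least : ∀ {A} (ψ : PObj (A × A)) → P₍ Δ ₎ ψ ≡ ⊤ → δ ≤ ψ
  δ-least {A} ψ ψ-refl = begin
    δ                                        ≡⟨ trans (P-cong δ ⟨π₁,π₂⟩≡id) (P-id δ) ⟨
    P₍ ⟨ π₁ , π₂ ⟩ ₎ δ                       ≤⟨ δ-subst π₁ π₂ φ ≤-refl φ-refl ⟩
    P₍ ⟨ id , π₂ ⟩ ₎ φ                       ≡⟨ trans (P-fuse ψ (solve {A = ι A ⊛ ι A} {B = ι A ⊛ ι A}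
                                                   (⋈₁T ∘T ⟪ idT , p₂ ⟫) idT refl)) (P-id ψ) ⟩
    ψ                                        ∎
    where
      open ≤-Reasoning
      φ : PObj ((A × A) × A)
      φ = P₍ ⟨ π₁ ∘ π₁ , π₂ ⟩ ₎ ψ
      φ-refl : P₍ ⟨ π₁ , π₂ ⟩ ₎ δ ≤ P₍ ⟨ id , π₁ ⟩ ₎ φ
      φ-refl = ≤-trans (maximum _) (≤-reflexive (sym (begin-equality
        P₍ ⟨ id , π₁ ⟩ ₎ φ       ≡⟨ P-fuse ψ (solve {A = ι A ⊛ ι A} {B = ι A ⊛ ι A}
                                      (⋈₁T ∘T ⟪ idT , p₁ ⟫) (ΔT ∘T p₁) refl) ⟩
        P₍ Δ ∘ π₁ ₎ ψ            ≡⟨ P-∘ π₁ Δ ψ ⟩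
        P₍ π₁ ₎ (P₍ Δ ₎ ψ)       ≡⟨ cong P₍ π₁ ₎ ψ-refl ⟩
        P₍ π₁ ₎ ⊤                ≡⟨ P-⊤ π₁ ⟩
        ⊤                        ∎)))

  δ-cong : ∀ {A B} (k : A ⇒ B) → δ ≤ P₍ k ⁂ k ₎ δ
  δ-cong {A} {B} k = δ-least _ (trans (P-fuse δ (solve {A = ι A} {B = ι B ⊛ ι B}
                                   ((⌜ k ⌝ ⁂T ⌜ k ⌝) ∘T ΔT) ⟪ ⌜ k ⌝ , ⌜ k ⌝ ⟫ refl))
                                 (δ-reflexive k))

  δ-sym : ∀ {A} → P₍ swapC ₎ δ ≡ δ {A}
  δ-sym {A} = ≤-antisym
    (≤-trans (P-monotone swapC δ≤swap) (≤-reflexive (trans (P-fuse δ swapC∘swapC) (P-id δ))))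
    δ≤swap
    where
      δ≤swap : δ ≤ P₍ swapC ₎ δ
      δ≤swap = δ-least _ (trans (P-fuse δ (solve {A = ι A} {B = ι A ⊛ ι A}
                                  (swapT ∘T ΔT) ΔT refl))
                                (δ-reflexive id))

  δ-split-mono : ∀ {A B} (φ : A ⇒ B) (ψ : B ⇒ A) → ψ ∘ φ ≡ id → P₍ φ ⁂ φ ₎ δ ≡ δ
  δ-split-mono {A} {B} φ ψ ψ∘φ≡id = ≤-antisym
    (begin
      P₍ φ ⁂ φ ₎ δ                  ≤⟨ P-monotone (φ ⁂ φ) (δ-cong ψ) ⟩
      P₍ φ ⁂ φ ₎ (P₍ ψ ⁂ ψ ₎ δ)     ≡⟨ P-fuse δ (solve {A = ι A ⊛ ι A} {B = ι A ⊛ ι A}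
                                        ((⌜ ψ ⌝ ⁂T ⌜ ψ ⌝) ∘T (⌜ φ ⌝ ⁂T ⌜ φ ⌝)) ((⌜ ψ ⌝ ∘T ⌜ φ ⌝) ⁂T (⌜ ψ ⌝ ∘T ⌜ φ ⌝)) refl) ⟩
      P₍ (ψ ∘ φ) ⁂ (ψ ∘ φ) ₎ δ      ≡⟨ P-cong δ (cong (λ k → k ⁂ k) ψ∘φ≡id) ⟩
      P₍ id ⁂ id ₎ δ                ≡⟨ P-cong δ id⁂id≡id ⟩
      P₍ id ₎ δ                     ≡⟨ P-id δ ⟩
      δ                             ∎)
    (δ-cong φ)
    where open ≤-Reasoning

  -- (f ⋈ g)((x , z) , y) = f(x , y) ∧ g(y , z), so that f ⨟ g quantifies y away.
  infixl 5 _⋈_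
  _⋈_ : ∀ {X Y Z} → Hom X Y → Hom Y Z → PObj ((X × Z) × Y)
  f ⋈ g = P₍ ⟨ π₁ ∘ π₁ , π₂ ⟩ ₎ f ∧ P₍ ⟨ π₂ , π₂ ∘ π₁ ⟩ ₎ g

  ⨟-as-∃₁ : ∀ {X Y Z} (f : Hom X Y) (g : Hom Y Z) → f ⨟ g ≡ ∃₁ (f ⋈ g)
  ⨟-as-∃₁ {X} {Y} {Z} f g = cong ∃₁ (trans (P-∧ _ _ _) (cong₂ _∧_
    (P-fuse f (solve {A = (ι X ⊛ ι Z) ⊛ ι Y} {B = ι X ⊛ ι Y}
                (⟪ p₁ , p₁ ∘T p₂ ⟫ ∘T ⟪ p₁ ∘T p₁ , ⋈₂T ⟫) ⋈₁T refl))
    (P-fuse g (solve {A = (ι X ⊛ ι Z) ⊛ ι Y} {B = ι Y ⊛ ι Z}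
                (⟪ p₁ ∘T p₂ , p₂ ∘T p₂ ⟫ ∘T ⟪ p₁ ∘T p₁ , ⋈₂T ⟫) ⋈₂T refl))))

  ⨟-identityˡ : ∀ {X Z} (g : Hom X Z) → δ ⨟ g ≡ g
  ⨟-identityˡ {X} {Z} g = trans (⨟-as-∃₁ δ g) (≤-antisym (∃₁-least δ⋈g≤g) g≤∃δ⋈g)
    where
      open ≤-Reasoning
      XZX = (ι X ⊛ ι Z) ⊛ ι X
      φ : PObj (((X × Z) × X) × X)
      φ = P₍ ⟨ π₂ , π₂ ∘ π₁ ∘ π₁ ⟩ ₎ g
      y≈x : δ ⋈ g ≤ P₍ ⟨ π₂ , π₁ ∘ π₁ ⟩ ₎ δ
      y≈x = ≤-trans (x∧y≤x _ _) (≤-reflexive (begin-equality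
        P₍ ⟨ π₁ ∘ π₁ , π₂ ⟩ ₎ δ              ≡⟨ cong P₍ _ ₎ δ-sym ⟨
        P₍ ⟨ π₁ ∘ π₁ , π₂ ⟩ ₎ (P₍ swapC ₎ δ) ≡⟨ P-fuse δ (solve {A = XZX} {B = ι X ⊛ ι X}
                                                (swapT ∘T ⋈₁T) ⟪ p₂ , p₁ ∘T p₁ ⟫ refl) ⟩
        P₍ ⟨ π₂ , π₁ ∘ π₁ ⟩ ₎ δ              ∎))
      gyz : δ ⋈ g ≤ P₍ ⟨ id , π₂ ⟩ ₎ φ
      gyz = ≤-trans (x∧y≤y _ _) (≤-reflexive (sym (P-fuse g
        (solve {A = XZX} {B = ι X ⊛ ι Z} (⟪ p₂ , p₂ ∘T p₁ ∘T p₁ ⟫ ∘T ⟪ idT , p₂ ⟫) ⋈₂T refl))))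
      δ⋈g≤g : δ ⋈ g ≤ P₍ π₁ ₎ g
      δ⋈g≤g = begin
        δ ⋈ g                       ≤⟨ δ-subst π₂ (π₁ ∘ π₁) φ y≈x gyz ⟩
        P₍ ⟨ id , π₁ ∘ π₁ ⟩ ₎ φ     ≡⟨ P-fuse g (solve {A = XZX} {B = ι X ⊛ ι Z}
                                        (⟪ p₂ , p₂ ∘T p₁ ∘T p₁ ⟫ ∘T ⟪ idT , p₁ ∘T p₁ ⟫) p₁ refl) ⟩
        P₍ π₁ ₎ g                   ∎
      g≤∃δ⋈g : g ≤ ∃₁ (δ ⋈ g)
      g≤∃δ⋈g = begin
        g                                    ≡⟨ ∧-identityˡ g ⟨
        ⊤ ∧ g                                ≡⟨ cong₂ _∧_
          (trans (P-fuse δ (solve {A = ι X ⊛ ι Z} {B = ι X ⊛ ι X} (⋈₁T ∘T ⟪ idT , p₁ ⟫) ⟪ p₁ , p₁ ⟫ refl))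
                 (δ-reflexive π₁))
          (trans (P-fuse g (solve {A = ι X ⊛ ι Z} {B = ι X ⊛ ι Z} (⋈₂T ∘T ⟪ idT , p₁ ⟫) idT refl))
                 (P-id g)) ⟨
        P₍ ⟨ id , π₁ ⟩ ₎ (P₍ ⟨ π₁ ∘ π₁ , π₂ ⟩ ₎ δ) ∧ P₍ ⟨ id , π₁ ⟩ ₎ (P₍ ⟨ π₂ , π₂ ∘ π₁ ⟩ ₎ g)
                                             ≡⟨ P-∧ _ _ _ ⟨
        P₍ ⟨ id , π₁ ⟩ ₎ (δ ⋈ g)             ≤⟨ ∃₁-intro (δ ⋈ g) π₁ ⟩
        ∃₁ (δ ⋈ g)                           ∎

  ⨟-identityʳ : ∀ {X Y} (f : Hom X Y) → f ⨟ δ ≡ f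
  ⨟-identityʳ {X} {Y} f = trans (⨟-as-∃₁ f δ) (≤-antisym (∃₁-least f⋈δ≤f) f≤∃f⋈δ)
    where
      open ≤-Reasoning
      XYY = (ι X ⊛ ι Y) ⊛ ι Y
      φ : PObj (((X × Y) × Y) × Y)
      φ = P₍ ⟨ π₁ ∘ π₁ ∘ π₁ , π₂ ⟩ ₎ f
      fxy : f ⋈ δ ≤ P₍ ⟨ id , π₂ ⟩ ₎ φ
      fxy = ≤-trans (x∧y≤x _ _) (≤-reflexive (sym (P-fuse f
        (solve {A = XYY} {B = ι X ⊛ ι Y} (⟪ p₁ ∘T p₁ ∘T p₁ , p₂ ⟫ ∘T ⟪ idT , p₂ ⟫) ⋈₁T refl))))
      f⋈δ≤f : f ⋈ δ ≤ P₍ π₁ ₎ f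
      f⋈δ≤f = begin
        f ⋈ δ                       ≤⟨ δ-subst π₂ (π₂ ∘ π₁) φ (x∧y≤y _ _) fxy ⟩
        P₍ ⟨ id , π₂ ∘ π₁ ⟩ ₎ φ     ≡⟨ P-fuse f (solve {A = XYY} {B = ι X ⊛ ι Y}
                                        (⟪ p₁ ∘T p₁ ∘T p₁ , p₂ ⟫ ∘T ⟪ idT , p₂ ∘T p₁ ⟫) p₁ refl) ⟩
        P₍ π₁ ₎ f                   ∎
      f≤∃f⋈δ : f ≤ ∃₁ (f ⋈ δ)
      f≤∃f⋈δ = begin
        f                                    ≡⟨ ∧-identityʳ f ⟨
        f ∧ ⊤                                ≡⟨ cong₂ _∧_
          (trans (P-fuse f (solve {A = ι X ⊛ ι Y} {B = ι X ⊛ ι Y} (⋈₁T ∘T ⟪ idT , p₂ ⟫) idT refl))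
                 (P-id f))
          (trans (P-fuse δ (solve {A = ι X ⊛ ι Y} {B = ι Y ⊛ ι Y} (⋈₂T ∘T ⟪ idT , p₂ ⟫) ⟪ p₂ , p₂ ⟫ refl))
                 (δ-reflexive π₂)) ⟨
        P₍ ⟨ id , π₂ ⟩ ₎ (P₍ ⟨ π₁ ∘ π₁ , π₂ ⟩ ₎ f) ∧ P₍ ⟨ id , π₂ ⟩ ₎ (P₍ ⟨ π₂ , π₂ ∘ π₁ ⟩ ₎ δ)
                                             ≡⟨ P-∧ _ _ _ ⟨
        P₍ ⟨ id , π₂ ⟩ ₎ (f ⋈ δ)             ≤⟨ ∃₁-intro (f ⋈ δ) π₂ ⟩
        ∃₁ (f ⋈ δ)                           ∎

  ⨟-reindexˡ : ∀ {X′ X Y Z} (k : X′ ⇒ X) (f : Hom X Y) (g : Hom Y Z) →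
               P₍ k ⁂ id ₎ (f ⨟ g) ≡ P₍ k ⁂ id ₎ f ⨟ g
  ⨟-reindexˡ {X′} {X} {Y} {Z} k f g = begin
    P₍ k ⁂ id ₎ (f ⨟ g)              ≡⟨ cong P₍ k ⁂ id ₎ (⨟-as-∃₁ f g) ⟩
    P₍ k ⁂ id ₎ (∃₁ (f ⋈ g))         ≡⟨ ∃₁-BC (k ⁂ id) (f ⋈ g) ⟨
    ∃₁ (P₍ (k ⁂ id) ⁂ id ₎ (f ⋈ g))  ≡⟨ cong ∃₁ (trans (P-∧ _ _ _) (cong₂ _∧_
      (P-square f (solve {A = (ι X′ ⊛ ι Z) ⊛ ι Y} {B = ι X ⊛ ι Y}
                    (⋈₁T ∘T ((⌜ k ⌝ ⁂T idT) ⁂T idT)) ((⌜ k ⌝ ⁂T idT) ∘T ⋈₁T) refl))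
      (P-fuse g (solve {A = (ι X′ ⊛ ι Z) ⊛ ι Y} {B = ι Y ⊛ ι Z}
                  (⋈₂T ∘T ((⌜ k ⌝ ⁂T idT) ⁂T idT)) ⋈₂T refl)))) ⟩
    ∃₁ (P₍ k ⁂ id ₎ f ⋈ g)           ≡⟨ ⨟-as-∃₁ _ g ⟨
    P₍ k ⁂ id ₎ f ⨟ g                ∎
    where open ≡-Reasoning

  ⨟-reindexʳ : ∀ {X Y Z Z′} (k : Z′ ⇒ Z) (f : Hom X Y) (g : Hom Y Z) →
               P₍ id ⁂ k ₎ (f ⨟ g) ≡ f ⨟ P₍ id ⁂ k ₎ g
  ⨟-reindexʳ {X} {Y} {Z} {Z′} k f g = begin
    P₍ id ⁂ k ₎ (f ⨟ g)              ≡⟨ cong P₍ id ⁂ k ₎ (⨟-as-∃₁ f g) ⟩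
    P₍ id ⁂ k ₎ (∃₁ (f ⋈ g))         ≡⟨ ∃₁-BC (id ⁂ k) (f ⋈ g) ⟨
    ∃₁ (P₍ (id ⁂ k) ⁂ id ₎ (f ⋈ g))  ≡⟨ cong ∃₁ (trans (P-∧ _ _ _) (cong₂ _∧_
      (P-fuse f (solve {A = (ι X ⊛ ι Z′) ⊛ ι Y} {B = ι X ⊛ ι Y}
                  (⋈₁T ∘T ((idT ⁂T ⌜ k ⌝) ⁂T idT)) ⋈₁T refl))
      (P-square g (solve {A = (ι X ⊛ ι Z′) ⊛ ι Y} {B = ι Y ⊛ ι Z}
                    (⋈₂T ∘T ((idT ⁂T ⌜ k ⌝) ⁂T idT)) ((idT ⁂T ⌜ k ⌝) ∘T ⋈₂T) refl)))) ⟩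
    ∃₁ (f ⋈ P₍ id ⁂ k ₎ g)           ≡⟨ ⨟-as-∃₁ f _ ⟨
    f ⨟ P₍ id ⁂ k ₎ g                ∎
    where open ≡-Reasoning

  ∃₁²-unit : ∀ {A B D} (α : PObj ((A × B) × D)) → α ≤ P₍ π₁ ₎ (P₍ π₁ ₎ (∃₁ (∃₁ α)))
  ∃₁²-unit α = ≤-trans (∃₁-unit α) (P-monotone π₁ (∃₁-unit (∃₁ α)))

  P-exchange-involutive : ∀ {A B D} (α : PObj ((A × B) × D)) → P₍ exchange ₎ (P₍ exchange ₎ α) ≡ α
  P-exchange-involutive {A} {B} {D} α = trans
    (P-fuse α (solve {A = (ι A ⊛ ι B) ⊛ ι D} {B = (ι A ⊛ ι B) ⊛ ι D} (exchangeT ∘T exchangeT) idT refl))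
    (P-id α)

  ∃₁²-exchange-≤ : ∀ {A B D} (α : PObj ((A × B) × D)) → ∃₁ (∃₁ α) ≤ ∃₁ (∃₁ (P₍ exchange ₎ α))
  ∃₁²-exchange-≤ {A} {B} {D} α = ∃₁-least (∃₁-least (begin
    α                                       ≡⟨ P-exchange-involutive α ⟨
    P₍ exchange ₎ (P₍ exchange ₎ α)         ≤⟨ P-monotone exchange (∃₁²-unit (P₍ exchange ₎ α)) ⟩
    P₍ exchange ₎ (P₍ π₁ ₎ (P₍ π₁ ₎ β))     ≡⟨ P-fuse₃ β (solve {A = (ι A ⊛ ι B) ⊛ ι D} {B = ι A}
                                                 ((p₁ ∘T p₁) ∘T exchangeT) (p₁ ∘T p₁) refl) ⟩
    P₍ π₁ ∘ π₁ ₎ β                          ≡⟨ P-∘ π₁ π₁ β ⟩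
    P₍ π₁ ₎ (P₍ π₁ ₎ β)                     ∎))
    where
      open ≤-Reasoning
      β = ∃₁ (∃₁ (P₍ exchange ₎ α))

  ∃₁²-exchange : ∀ {A B D} (α : PObj ((A × B) × D)) → ∃₁ (∃₁ α) ≡ ∃₁ (∃₁ (P₍ exchange ₎ α))
  ∃₁²-exchange α = ≤-antisym (∃₁²-exchange-≤ α)
    (≤-trans (∃₁²-exchange-≤ (P₍ exchange ₎ α)) (≤-reflexive (cong (λ β → ∃₁ (∃₁ β)) (P-exchange-involutive α))))

  ∃₁-pair : ∀ {A B D} (α : PObj (A × (B × D))) → ∃₁ α ≡ ∃₁ (∃₁ (P₍ assocC ₎ α))
  ∃₁-pair {A} {B} {D} α = ≤-antisym
    (∃₁-least (begin
      α                                         ≡⟨ trans (P-fuse α assocC∘assocC⁻¹) (P-id α) ⟨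
      P₍ assocC⁻¹ ₎ (P₍ assocC ₎ α)             ≤⟨ P-monotone assocC⁻¹ (∃₁²-unit (P₍ assocC ₎ α)) ⟩
      P₍ assocC⁻¹ ₎ (P₍ π₁ ₎ (P₍ π₁ ₎ β))       ≡⟨ P-fuse₃ β (solve {A = ι A ⊛ (ι B ⊛ ι D)} {B = ι A}
                                                     ((p₁ ∘T p₁) ∘T assocT⁻¹) p₁ refl) ⟩
      P₍ π₁ ₎ β                                 ∎))
    (∃₁-least (∃₁-least (begin
      P₍ assocC ₎ α                             ≤⟨ P-monotone assocC (∃₁-unit α) ⟩
      P₍ assocC ₎ (P₍ π₁ ₎ (∃₁ α))              ≡⟨ P-fuse (∃₁ α) (solve {A = (ι A ⊛ ι B) ⊛ ι D} {B = ι A}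
                                                     (p₁ ∘T assocT) (p₁ ∘T p₁) refl) ⟩
      P₍ π₁ ∘ π₁ ₎ (∃₁ α)                       ≡⟨ P-∘ π₁ π₁ (∃₁ α) ⟩
      P₍ π₁ ₎ (P₍ π₁ ₎ (∃₁ α))                  ∎)))
    where
      open ≤-Reasoning
      β = ∃₁ (∃₁ (P₍ assocC ₎ α))

  ∧-P-∃₁ : ∀ {A A′ B} (c : PObj A′) (m : A′ ⇒ A) (β : PObj (A × B)) →
           c ∧ P₍ m ₎ (∃₁ β) ≡ ∃₁ (P₍ π₁ ₎ c ∧ P₍ m ⁂ id ₎ β)
  ∧-P-∃₁ c m β = trans (cong (c ∧_) (sym (∃₁-BC m β))) (sym (∃₁-Frob c _))

  ⨟-assoc : ∀ {X Y Z W} (f : Hom X Y) (g : Hom Y Z) (k : Hom Z W) → (f ⨟ g) ⨟ k ≡ f ⨟ (g ⨟ k)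
  ⨟-assoc {X} {Y} {Z} {W} f g k = begin
    (f ⨟ g) ⨟ k               ≡⟨ as-∃₁²ˡ ⟩
    ∃₁ (∃₁ (K ∧ (F ∧ G)))     ≡⟨ cong (λ β → ∃₁ (∃₁ β)) (trans (∧-comm K _) (∧-assoc F G K)) ⟩
    ∃₁ (∃₁ (F ∧ (G ∧ K)))     ≡⟨ as-∃₁²ʳ ⟨
    f ⨟ (g ⨟ k)               ∎
    where
      open ≡-Reasoning
      XWZY = ((ι X ⊛ ι W) ⊛ ι Z) ⊛ ι Y
      FT : Tm XWZY (ι X ⊛ ι Y)
      FT = ⟪ p₁ ∘T p₁ ∘T p₁ , p₂ ⟫
      KT : Tm XWZY (ι Z ⊛ ι W)
      KT = ⟪ p₂ ∘T p₁ , p₂ ∘T p₁ ∘T p₁ ⟫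
      F G K : PObj (((X × W) × Z) × Y)
      F = P₍ ⟦ FT ⟧T ₎ f
      G = P₍ ⟨ π₂ , π₂ ∘ π₁ ⟩ ₎ g
      K = P₍ ⟦ KT ⟧T ₎ k
      as-∃₁²ˡ : (f ⨟ g) ⨟ k ≡ ∃₁ (∃₁ (K ∧ (F ∧ G)))
      as-∃₁²ˡ = begin
        (f ⨟ g) ⨟ k                                      ≡⟨ ⨟-as-∃₁ _ k ⟩
        ∃₁ (P₍ ⟨ π₁ ∘ π₁ , π₂ ⟩ ₎ (f ⨟ g) ∧ P₍ ⟨ π₂ , π₂ ∘ π₁ ⟩ ₎ k)
          ≡⟨ cong ∃₁ (trans (∧-comm _ _) (cong (λ h → _ ∧ P₍ ⟨ π₁ ∘ π₁ , π₂ ⟩ ₎ h) (⨟-as-∃₁ f g))) ⟩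
        ∃₁ (P₍ ⟨ π₂ , π₂ ∘ π₁ ⟩ ₎ k ∧ P₍ ⟨ π₁ ∘ π₁ , π₂ ⟩ ₎ (∃₁ (f ⋈ g)))
          ≡⟨ cong ∃₁ (∧-P-∃₁ _ _ _) ⟩
        ∃₁ (∃₁ (P₍ π₁ ₎ (P₍ ⟨ π₂ , π₂ ∘ π₁ ⟩ ₎ k) ∧ P₍ ⟨ π₁ ∘ π₁ , π₂ ⟩ ⁂ id ₎ (f ⋈ g)))
          ≡⟨ cong (λ β → ∃₁ (∃₁ β)) (cong₂ _∧_
               (P-fuse k (solve {A = XWZY} {B = ι Z ⊛ ι W} (⋈₂T ∘T p₁) KT refl))
               (trans (P-∧ _ _ _) (cong₂ _∧_
                 (P-fuse f (solve {A = XWZY} {B = ι X ⊛ ι Y}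
                             (⋈₁T ∘T (⋈₁T ⁂T idT)) FT refl))
                 (P-fuse g (solve {A = XWZY} {B = ι Y ⊛ ι Z}
                             (⋈₂T ∘T (⋈₁T ⁂T idT)) ⋈₂T refl))))) ⟩
        ∃₁ (∃₁ (K ∧ (F ∧ G)))                            ∎
      as-∃₁²ʳ : f ⨟ (g ⨟ k) ≡ ∃₁ (∃₁ (F ∧ (G ∧ K)))
      as-∃₁²ʳ = begin
        f ⨟ (g ⨟ k)                                      ≡⟨ ⨟-as-∃₁ f _ ⟩
        ∃₁ (P₍ ⟨ π₁ ∘ π₁ , π₂ ⟩ ₎ f ∧ P₍ ⟨ π₂ , π₂ ∘ π₁ ⟩ ₎ (g ⨟ k))
          ≡⟨ cong (λ h → ∃₁ (_ ∧ P₍ ⟨ π₂ , π₂ ∘ π₁ ⟩ ₎ h)) (⨟-as-∃₁ g k) ⟩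
        ∃₁ (P₍ ⟨ π₁ ∘ π₁ , π₂ ⟩ ₎ f ∧ P₍ ⟨ π₂ , π₂ ∘ π₁ ⟩ ₎ (∃₁ (g ⋈ k)))
          ≡⟨ cong ∃₁ (∧-P-∃₁ _ _ _) ⟩
        ∃₁ (∃₁ (P₍ π₁ ₎ (P₍ ⟨ π₁ ∘ π₁ , π₂ ⟩ ₎ f) ∧ P₍ ⟨ π₂ , π₂ ∘ π₁ ⟩ ⁂ id ₎ (g ⋈ k)))
          ≡⟨ ∃₁²-exchange _ ⟩
        ∃₁ (∃₁ (P₍ exchange ₎ (P₍ π₁ ₎ (P₍ ⟨ π₁ ∘ π₁ , π₂ ⟩ ₎ f) ∧ P₍ ⟨ π₂ , π₂ ∘ π₁ ⟩ ⁂ id ₎ (g ⋈ k))))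
          ≡⟨ cong (λ β → ∃₁ (∃₁ β)) (trans (P-∧ _ _ _) (cong₂ _∧_
               (P-fuse₃ f (solve {A = XWZY} {B = ι X ⊛ ι Y}
                            ((⋈₁T ∘T p₁) ∘T exchangeT) FT refl))
               (trans (cong P₍ exchange ₎ (P-∧ _ _ _)) (trans (P-∧ _ _ _) (cong₂ _∧_
                 (P-fuse₃ g (solve {A = XWZY} {B = ι Y ⊛ ι Z}
                              ((⋈₁T ∘T (⋈₂T ⁂T idT)) ∘T exchangeT) ⋈₂T refl))
                 (P-fuse₃ k (solve {A = XWZY} {B = ι Z ⊛ ι W}
                              ((⋈₂T ∘T (⋈₂T ⁂T idT)) ∘T exchangeT)
                              KT refl))))))) ⟩
        ∃₁ (∃₁ (F ∧ (G ∧ K)))                            ∎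

  ⊗-δ : ∀ {A B} → δ {A} ⊗ δ {B} ≡ δ
  ⊗-δ {A} {B} = ≤-antisym δ⊗δ≤δ (∧-greatest (δ-cong π₁) (δ-cong π₂))
    where
      open ≤-Reasoning
      ABAB = (ι A ⊛ ι B) ⊛ (ι A ⊛ ι B)
      φ₁ : PObj (((A × B) × (A × B)) × A)
      φ₁ = P₍ ⟨ π₁ ∘ π₁ , ⟨ π₂ , π₂ ∘ π₁ ∘ π₁ ⟩ ⟩ ₎ δ
      φ₂ : PObj (((A × B) × (A × B)) × B)
      φ₂ = P₍ ⟨ π₁ ∘ π₁ , ⟨ π₁ ∘ π₂ ∘ π₁ , π₂ ⟩ ⟩ ₎ δ
      -- Rewrite (a , b) = (a , b) along a = a′, then along b = b′.
      first-equal : δ ⊗ δ ≤ P₍ ⟨ id , π₁ ∘ π₂ ⟩ ₎ φ₁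
      first-equal = δ-subst (π₁ ∘ π₁) (π₁ ∘ π₂) φ₁ (x∧y≤x _ _) (≤-trans (maximum _) (≤-reflexive (sym
        (trans (P-fuse δ (solve {A = ABAB} {B = (ι A ⊛ ι B) ⊛ (ι A ⊛ ι B)}
                  (⟪ p₁ ∘T p₁ , ⟪ p₂ , p₂ ∘T p₁ ∘T p₁ ⟫ ⟫ ∘T ⟪ idT , p₁ ∘T p₁ ⟫) ⟪ p₁ , p₁ ⟫ refl))
               (δ-reflexive π₁)))))
      δ⊗δ≤δ : δ ⊗ δ ≤ δ
      δ⊗δ≤δ = begin
        δ ⊗ δ                        ≤⟨ δ-subst (π₂ ∘ π₁) (π₂ ∘ π₂) φ₂ (x∧y≤y _ _) (≤-trans first-equal (≤-reflexive
                                        (P-square δ (solve {A = ABAB} {B = (ι A ⊛ ι B) ⊛ (ι A ⊛ ι B)}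
                                          (⟪ p₁ ∘T p₁ , ⟪ p₂ , p₂ ∘T p₁ ∘T p₁ ⟫ ⟫ ∘T ⟪ idT , p₁ ∘T p₂ ⟫)
                                          (⟪ p₁ ∘T p₁ , ⟪ p₁ ∘T p₂ ∘T p₁ , p₂ ⟫ ⟫ ∘T ⟪ idT , p₂ ∘T p₁ ⟫) refl)))) ⟩
        P₍ ⟨ id , π₂ ∘ π₂ ⟩ ₎ φ₂     ≡⟨ trans (P-fuse δ (solve {A = ABAB} {B = (ι A ⊛ ι B) ⊛ (ι A ⊛ ι B)}
                                         (⟪ p₁ ∘T p₁ , ⟪ p₁ ∘T p₂ ∘T p₁ , p₂ ⟫ ⟫ ∘T ⟪ idT , p₂ ∘T p₂ ⟫) idT refl))
                                         (P-id δ) ⟩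
        δ                            ∎

  ⊗-⨟ : ∀ {A₁ B₁ C₁ A₂ B₂ C₂} (f₁ : Hom A₁ B₁) (g₁ : Hom B₁ C₁) (f₂ : Hom A₂ B₂) (g₂ : Hom B₂ C₂) →
        (f₁ ⨟ g₁) ⊗ (f₂ ⨟ g₂) ≡ (f₁ ⊗ f₂) ⨟ (g₁ ⊗ g₂)
  ⊗-⨟ {A₁} {B₁} {C₁} {A₂} {B₂} {C₂} f₁ g₁ f₂ g₂ = begin
    (f₁ ⨟ g₁) ⊗ (f₂ ⨟ g₂)               ≡⟨ as-∃₁²ˡ ⟩
    ∃₁ (∃₁ ((F₂ ∧ G₂) ∧ (F₁ ∧ G₁)))     ≡⟨ cong (λ β → ∃₁ (∃₁ β)) (trans (∧-comm _ _) (∧-interchange _ _ _ _)) ⟩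
    ∃₁ (∃₁ ((F₁ ∧ F₂) ∧ (G₁ ∧ G₂)))     ≡⟨ as-∃₁²ʳ ⟨
    (f₁ ⊗ f₂) ⨟ (g₁ ⊗ g₂)               ∎
    where
      open ≡-Reasoning
      Γ₄ = (((ι A₁ ⊛ ι A₂) ⊛ (ι C₁ ⊛ ι C₂)) ⊛ ι B₂) ⊛ ι B₁
      F₁T : Tm Γ₄ (ι A₁ ⊛ ι B₁)
      F₁T = ⟪ p₁ ∘T p₁ ∘T p₁ ∘T p₁ , p₂ ⟫
      G₁T : Tm Γ₄ (ι B₁ ⊛ ι C₁)
      G₁T = ⟪ p₂ , p₁ ∘T p₂ ∘T p₁ ∘T p₁ ⟫
      F₂T : Tm Γ₄ (ι A₂ ⊛ ι B₂)
      F₂T = ⟪ p₂ ∘T p₁ ∘T p₁ ∘T p₁ , p₂ ∘T p₁ ⟫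
      G₂T : Tm Γ₄ (ι B₂ ⊛ ι C₂)
      G₂T = ⟪ p₂ ∘T p₁ , p₂ ∘T p₂ ∘T p₁ ∘T p₁ ⟫
      F₁ G₁ F₂ G₂ : PObj ((((A₁ × A₂) × (C₁ × C₂)) × B₂) × B₁)
      F₁ = P₍ ⟦ F₁T ⟧T ₎ f₁
      G₁ = P₍ ⟦ G₁T ⟧T ₎ g₁
      F₂ = P₍ ⟦ F₂T ⟧T ₎ f₂
      G₂ = P₍ ⟦ G₂T ⟧T ₎ g₂
      a : ((A₁ × A₂) × (C₁ × C₂)) ⇒ (A₁ × C₁)
      a = ⟨ π₁ ∘ π₁ , π₁ ∘ π₂ ⟩
      b : ((A₁ × A₂) × (C₁ × C₂)) ⇒ (A₂ × C₂)
      b = ⟨ π₂ ∘ π₁ , π₂ ∘ π₂ ⟩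
      as-∃₁²ˡ : (f₁ ⨟ g₁) ⊗ (f₂ ⨟ g₂) ≡ ∃₁ (∃₁ ((F₂ ∧ G₂) ∧ (F₁ ∧ G₁)))
      as-∃₁²ˡ = begin
        P₍ a ₎ (f₁ ⨟ g₁) ∧ P₍ b ₎ (f₂ ⨟ g₂)
          ≡⟨ cong₂ (λ h₁ h₂ → P₍ a ₎ h₁ ∧ P₍ b ₎ h₂) (⨟-as-∃₁ f₁ g₁) (⨟-as-∃₁ f₂ g₂) ⟩
        P₍ a ₎ (∃₁ (f₁ ⋈ g₁)) ∧ P₍ b ₎ (∃₁ (f₂ ⋈ g₂))
          ≡⟨ ∧-P-∃₁ _ b _ ⟩
        ∃₁ (P₍ π₁ ₎ (P₍ a ₎ (∃₁ (f₁ ⋈ g₁))) ∧ P₍ b ⁂ id ₎ (f₂ ⋈ g₂))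
          ≡⟨ cong ∃₁ (trans (∧-comm _ _) (cong (P₍ b ⁂ id ₎ (f₂ ⋈ g₂) ∧_) (P-fuse _ refl))) ⟩
        ∃₁ (P₍ b ⁂ id ₎ (f₂ ⋈ g₂) ∧ P₍ a ∘ π₁ ₎ (∃₁ (f₁ ⋈ g₁)))
          ≡⟨ cong ∃₁ (∧-P-∃₁ _ _ _) ⟩
        ∃₁ (∃₁ (P₍ π₁ ₎ (P₍ b ⁂ id ₎ (f₂ ⋈ g₂)) ∧ P₍ (a ∘ π₁) ⁂ id ₎ (f₁ ⋈ g₁)))
          ≡⟨ cong (λ β → ∃₁ (∃₁ β)) (cong₂ _∧_
               (trans (cong P₍ π₁ ₎ (P-∧ _ _ _)) (trans (P-∧ _ _ _) (cong₂ _∧_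
                 (P-fuse₃ f₂ (solve {A = Γ₄} {B = ι A₂ ⊛ ι B₂} ((⋈₁T ∘T (⊗₂T ⁂T idT)) ∘T p₁) F₂T refl))
                 (P-fuse₃ g₂ (solve {A = Γ₄} {B = ι B₂ ⊛ ι C₂} ((⋈₂T ∘T (⊗₂T ⁂T idT)) ∘T p₁) G₂T refl)))))
               (trans (P-∧ _ _ _) (cong₂ _∧_
                 (P-fuse f₁ (solve {A = Γ₄} {B = ι A₁ ⊛ ι B₁} (⋈₁T ∘T ((⊗₁T ∘T p₁) ⁂T idT)) F₁T refl))
                 (P-fuse g₁ (solve {A = Γ₄} {B = ι B₁ ⊛ ι C₁} (⋈₂T ∘T ((⊗₁T ∘T p₁) ⁂T idT)) G₁T refl))))) ⟩
        ∃₁ (∃₁ ((F₂ ∧ G₂) ∧ (F₁ ∧ G₁)))    ∎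
      as-∃₁²ʳ : (f₁ ⊗ f₂) ⨟ (g₁ ⊗ g₂) ≡ ∃₁ (∃₁ ((F₁ ∧ F₂) ∧ (G₁ ∧ G₂)))
      as-∃₁²ʳ = begin
        (f₁ ⊗ f₂) ⨟ (g₁ ⊗ g₂)                                         ≡⟨ ⨟-as-∃₁ _ _ ⟩
        ∃₁ ((f₁ ⊗ f₂) ⋈ (g₁ ⊗ g₂))                                    ≡⟨ ∃₁-pair _ ⟩
        ∃₁ (∃₁ (P₍ assocC ₎ ((f₁ ⊗ f₂) ⋈ (g₁ ⊗ g₂))))                 ≡⟨ ∃₁²-exchange _ ⟩
        ∃₁ (∃₁ (P₍ exchange ₎ (P₍ assocC ₎ ((f₁ ⊗ f₂) ⋈ (g₁ ⊗ g₂))))) ≡⟨ cong (λ β → ∃₁ (∃₁ β)) (begin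
          P₍ exchange ₎ (P₍ assocC ₎ (P₍ _ ₎ (f₁ ⊗ f₂) ∧ P₍ _ ₎ (g₁ ⊗ g₂)))
            ≡⟨ P-fuse _ refl ⟩
          P₍ assocC ∘ exchange ₎ (P₍ _ ₎ (f₁ ⊗ f₂) ∧ P₍ _ ₎ (g₁ ⊗ g₂))
            ≡⟨ P-∧ _ _ _ ⟩
          P₍ assocC ∘ exchange ₎ (P₍ _ ₎ (f₁ ⊗ f₂)) ∧ P₍ assocC ∘ exchange ₎ (P₍ _ ₎ (g₁ ⊗ g₂))
            ≡⟨ cong₂ _∧_
                 (trans (cong P₍ _ ₎ (P-∧ _ _ _)) (trans (P-∧ _ _ _) (cong₂ _∧_
                   (P-fuse₃ f₁ (solve {A = Γ₄} {B = ι A₁ ⊛ ι B₁} ((⊗₁T ∘T ⋈₁T) ∘T (assocT ∘T exchangeT)) F₁T refl))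
                   (P-fuse₃ f₂ (solve {A = Γ₄} {B = ι A₂ ⊛ ι B₂} ((⊗₂T ∘T ⋈₁T) ∘T (assocT ∘T exchangeT)) F₂T refl)))))
                 (trans (cong P₍ _ ₎ (P-∧ _ _ _)) (trans (P-∧ _ _ _) (cong₂ _∧_
                   (P-fuse₃ g₁ (solve {A = Γ₄} {B = ι B₁ ⊛ ι C₁} ((⊗₁T ∘T ⋈₂T) ∘T (assocT ∘T exchangeT)) G₁T refl))
                   (P-fuse₃ g₂ (solve {A = Γ₄} {B = ι B₂ ⊛ ι C₂} ((⊗₂T ∘T ⋈₂T) ∘T (assocT ∘T exchangeT)) G₂T refl))))) ⟩
          (F₁ ∧ F₂) ∧ (G₁ ∧ G₂)                                        ∎) ⟩
        ∃₁ (∃₁ ((F₁ ∧ F₂) ∧ (G₁ ∧ G₂)))                               ∎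

  Γ-⨟ : ∀ {X X′ Y} (f : X′ ⇒ X) (R : Hom X Y) → Γ f ⨟ R ≡ P₍ f ⁂ id ₎ R
  Γ-⨟ f R = trans (sym (⨟-reindexˡ f δ R)) (cong P₍ f ⁂ id ₎ (⨟-identityˡ R))

  Γ-id : ∀ {X} → Γ (id {X}) ≡ δ
  Γ-id = trans (P-cong δ id⁂id≡id) (P-id δ)

  Γ-∘ : ∀ {X Y Z} (f : X ⇒ Y) (g : Y ⇒ Z) → Γ f ⨟ Γ g ≡ Γ (g ∘ f)
  Γ-∘ {X} {Y} {Z} f g = trans (Γ-⨟ f (Γ g)) (P-fuse δ (solve {A = ι X ⊛ ι Z} {B = ι Z ⊛ ι Z}
    ((⌜ g ⌝ ⁂T idT) ∘T (⌜ f ⌝ ⁂T idT)) ((⌜ g ⌝ ∘T ⌜ f ⌝) ⁂T idT) refl))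

  Γ-iso : ∀ {A B} (φ : A ⇒ B) (ψ : B ⇒ A) → ψ ∘ φ ≡ id → φ ∘ ψ ≡ id → IsIso Hom δ _⨟_ (Γ φ)
  Γ-iso φ ψ ψ∘φ≡id φ∘ψ≡id =
    Γ ψ , trans (Γ-∘ φ ψ) (trans (cong Γ ψ∘φ≡id) Γ-id) , trans (Γ-∘ ψ φ) (trans (cong Γ φ∘ψ≡id) Γ-id)

  ⨟-Γ-iso : ∀ {X A B} (φ : A ⇒ B) (ψ : B ⇒ A) → ψ ∘ φ ≡ id → φ ∘ ψ ≡ id →
            (R : Hom X A) → R ⨟ Γ φ ≡ P₍ id ⁂ ψ ₎ R
  ⨟-Γ-iso {X} {A} {B} φ ψ ψ∘φ≡id φ∘ψ≡id R = begin
    R ⨟ Γ φ                       ≡⟨ cong (R ⨟_) Γφ≡ ⟩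
    R ⨟ P₍ id ⁂ ψ ₎ δ             ≡⟨ ⨟-reindexʳ ψ R δ ⟨
    P₍ id ⁂ ψ ₎ (R ⨟ δ)           ≡⟨ cong P₍ id ⁂ ψ ₎ (⨟-identityʳ R) ⟩
    P₍ id ⁂ ψ ₎ R                 ∎
    where
      open ≡-Reasoning
      Γφ≡ : Γ φ ≡ P₍ id ⁂ ψ ₎ δ
      Γφ≡ = begin
        P₍ φ ⁂ id ₎ δ                    ≡⟨ P-cong δ (cong (φ ⁂_) φ∘ψ≡id) ⟨
        P₍ φ ⁂ (φ ∘ ψ) ₎ δ               ≡⟨ P-fuse δ (solve {A = ι A ⊛ ι B} {B = ι B ⊛ ι B}
                                              ((⌜ φ ⌝ ⁂T ⌜ φ ⌝) ∘T (idT ⁂T ⌜ ψ ⌝)) (⌜ φ ⌝ ⁂T (⌜ φ ⌝ ∘T ⌜ ψ ⌝)) refl) ⟨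
        P₍ id ⁂ ψ ₎ (P₍ φ ⁂ φ ₎ δ)       ≡⟨ cong P₍ id ⁂ ψ ₎ (δ-split-mono φ ψ ψ∘φ≡id) ⟩
        P₍ id ⁂ ψ ₎ δ                    ∎

  Γ-⊗ : ∀ {A B C D} (f : A ⇒ B) (g : C ⇒ D) → Γ f ⊗ Γ g ≡ Γ (f ⁂ g)
  Γ-⊗ {A} {B} {C} {D} f g = begin
    Γ f ⊗ Γ g
      ≡⟨ cong₂ _∧_
           (P-square δ (solve {A = Γ₂} {B = ι B ⊛ ι B} ((⌜ f ⌝ ⁂T idT) ∘T ⊗₁T) (⊗₁T ∘T ((⌜ f ⌝ ⁂T ⌜ g ⌝) ⁂T idT)) refl))
           (P-square δ (solve {A = Γ₂} {B = ι D ⊛ ι D} ((⌜ g ⌝ ⁂T idT) ∘T ⊗₂T) (⊗₂T ∘T ((⌜ f ⌝ ⁂T ⌜ g ⌝) ⁂T idT)) refl)) ⟩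
    P₍ (f ⁂ g) ⁂ id ₎ (P₍ ⟨ π₁ ∘ π₁ , π₁ ∘ π₂ ⟩ ₎ δ) ∧ P₍ (f ⁂ g) ⁂ id ₎ (P₍ ⟨ π₂ ∘ π₁ , π₂ ∘ π₂ ⟩ ₎ δ)
      ≡⟨ P-∧ _ _ _ ⟨
    P₍ (f ⁂ g) ⁂ id ₎ (δ ⊗ δ)
      ≡⟨ cong P₍ (f ⁂ g) ⁂ id ₎ ⊗-δ ⟩
    Γ (f ⁂ g)
      ∎
    where
      open ≡-Reasoning
      Γ₂ = (ι A ⊛ ι C) ⊛ (ι B ⊛ ι D)

  δ-terminal : ∀ {Z} (m : Z ⇒ (I × I)) → P₍ m ₎ δ ≡ ⊤
  δ-terminal m = trans (P-cong δ (trans (sym unique) (cong₂ ⟨_,_⟩ (!-unique _) (!-unique _)))) (δ-reflexive !)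

  α-nat : ∀ {A A′ B B′ C C′} (f : Hom A A′) (g : Hom B B′) (k : Hom C C′) →
          ((f ⊗ g) ⊗ k) ⨟ αA ≡ αA ⨟ (f ⊗ (g ⊗ k))
  α-nat {A} {A′} {B} {B′} {C} {C′} f g k = begin
    ((f ⊗ g) ⊗ k) ⨟ αA                 ≡⟨ ⨟-Γ-iso assocC assocC⁻¹ assocC⁻¹∘assocC assocC∘assocC⁻¹ _ ⟩
    P₍ id ⁂ assocC⁻¹ ₎ ((f ⊗ g) ⊗ k)   ≡⟨ trans (P-∧ _ _ _) (cong₂ _∧_
        (trans (cong P₍ _ ₎ (P-∧ _ _ _)) (trans (P-∧ _ _ _) (cong₂ _∧_
          (P-fuse₃ f (solve {A = Γ₆} {B = ι A ⊛ ι A′} ((⊗₁T ∘T ⊗₁T) ∘T (idT ⁂T assocT⁻¹)) FT refl))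
          (P-fuse₃ g (solve {A = Γ₆} {B = ι B ⊛ ι B′} ((⊗₂T ∘T ⊗₁T) ∘T (idT ⁂T assocT⁻¹)) GT refl)))))
        (P-fuse k (solve {A = Γ₆} {B = ι C ⊛ ι C′} (⊗₂T ∘T (idT ⁂T assocT⁻¹)) KT refl))) ⟩
    (F ∧ G) ∧ K                        ≡⟨ ∧-assoc F G K ⟩
    F ∧ (G ∧ K)                        ≡⟨ trans (P-∧ _ _ _) (cong₂ _∧_
        (P-fuse f (solve {A = Γ₆} {B = ι A ⊛ ι A′} (⊗₁T ∘T (assocT ⁂T idT)) FT refl))
        (trans (cong P₍ _ ₎ (P-∧ _ _ _)) (trans (P-∧ _ _ _) (cong₂ _∧_
          (P-fuse₃ g (solve {A = Γ₆} {B = ι B ⊛ ι B′} ((⊗₁T ∘T ⊗₂T) ∘T (assocT ⁂T idT)) GT refl))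
          (P-fuse₃ k (solve {A = Γ₆} {B = ι C ⊛ ι C′} ((⊗₂T ∘T ⊗₂T) ∘T (assocT ⁂T idT)) KT refl)))))) ⟨
    P₍ assocC ⁂ id ₎ (f ⊗ (g ⊗ k))     ≡⟨ Γ-⨟ assocC _ ⟨
    αA ⨟ (f ⊗ (g ⊗ k))                 ∎
    where
      open ≡-Reasoning
      Γ₆ = ((ι A ⊛ ι B) ⊛ ι C) ⊛ (ι A′ ⊛ (ι B′ ⊛ ι C′))
      FT = ⟪ p₁ ∘T p₁ ∘T p₁ , p₁ ∘T p₂ ⟫
      GT = ⟪ p₂ ∘T p₁ ∘T p₁ , p₁ ∘T p₂ ∘T p₂ ⟫
      KT = ⟪ p₂ ∘T p₁ , p₂ ∘T p₂ ∘T p₂ ⟫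
      F = P₍ ⟦ FT ⟧T ₎ f
      G = P₍ ⟦ GT ⟧T ₎ g
      K = P₍ ⟦ KT ⟧T ₎ k

  λ-nat : ∀ {A A′} (f : Hom A A′) → (δ {I} ⊗ f) ⨟ λA ≡ λA ⨟ f
  λ-nat {A} {A′} f = begin
    (δ ⊗ f) ⨟ λA                                  ≡⟨ ⨟-Γ-iso π₂ ⟨ ! , id ⟩ ⟨!,id⟩∘π₂≡id project₂ _ ⟩
    P₍ id ⁂ ⟨ ! , id ⟩ ₎ (δ ⊗ f)                  ≡⟨ P-∧ _ _ _ ⟩
    P₍ id ⁂ ⟨ ! , id ⟩ ₎ (P₍ _ ₎ δ) ∧ P₍ id ⁂ ⟨ ! , id ⟩ ₎ (P₍ _ ₎ f)
      ≡⟨ cong₂ _∧_ (trans (P-fuse δ refl) (δ-terminal _))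
                   (P-fuse f (solve {A = (ι I ⊛ ι A) ⊛ ι A′} {B = ι A ⊛ ι A′}
                                (⊗₂T ∘T (idT ⁂T ⟪ ⌜ ! ⌝ , idT ⟫)) (p₂ ⁂T idT) refl)) ⟩
    ⊤ ∧ P₍ π₂ ⁂ id ₎ f                            ≡⟨ ∧-identityˡ _ ⟩
    P₍ π₂ ⁂ id ₎ f                                ≡⟨ Γ-⨟ π₂ f ⟨
    λA ⨟ f                                        ∎
    where open ≡-Reasoning

  ρ-nat : ∀ {A A′} (f : Hom A A′) → (f ⊗ δ {I}) ⨟ ρA ≡ ρA ⨟ f
  ρ-nat {A} {A′} f = begin
    (f ⊗ δ) ⨟ ρA                                  ≡⟨ ⨟-Γ-iso π₁ ⟨ id , ! ⟩ ⟨id,!⟩∘π₁≡id project₁ _ ⟩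
    P₍ id ⁂ ⟨ id , ! ⟩ ₎ (f ⊗ δ)                  ≡⟨ P-∧ _ _ _ ⟩
    P₍ id ⁂ ⟨ id , ! ⟩ ₎ (P₍ _ ₎ f) ∧ P₍ id ⁂ ⟨ id , ! ⟩ ₎ (P₍ _ ₎ δ)
      ≡⟨ cong₂ _∧_ (P-fuse f (solve {A = (ι A ⊛ ι I) ⊛ ι A′} {B = ι A ⊛ ι A′}
                                (⊗₁T ∘T (idT ⁂T ⟪ idT , ⌜ ! ⌝ ⟫)) (p₁ ⁂T idT) refl))
                   (trans (P-fuse δ refl) (δ-terminal _)) ⟩
    P₍ π₁ ⁂ id ₎ f ∧ ⊤                            ≡⟨ ∧-identityʳ _ ⟩
    P₍ π₁ ⁂ id ₎ f                                ≡⟨ Γ-⨟ π₁ f ⟨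
    ρA ⨟ f                                        ∎
    where open ≡-Reasoning

  σ-nat : ∀ {A A′ B B′} (f : Hom A A′) (g : Hom B B′) → (f ⊗ g) ⨟ σA ≡ σA ⨟ (g ⊗ f)
  σ-nat {A} {A′} {B} {B′} f g = begin
    (f ⊗ g) ⨟ σA                                  ≡⟨ ⨟-Γ-iso swapC swapC swapC∘swapC swapC∘swapC _ ⟩
    P₍ id ⁂ swapC ₎ (f ⊗ g)                       ≡⟨ P-∧ _ _ _ ⟩
    P₍ id ⁂ swapC ₎ (P₍ _ ₎ f) ∧ P₍ id ⁂ swapC ₎ (P₍ _ ₎ g)
      ≡⟨ ∧-comm _ _ ⟩
    P₍ id ⁂ swapC ₎ (P₍ _ ₎ g) ∧ P₍ id ⁂ swapC ₎ (P₍ _ ₎ f)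
      ≡⟨ cong₂ _∧_ (P-square g (solve {A = Γ₄} {B = ι B ⊛ ι B′} (⊗₂T ∘T (idT ⁂T swapT)) (⊗₁T ∘T (swapT ⁂T idT)) refl))
                   (P-square f (solve {A = Γ₄} {B = ι A ⊛ ι A′} (⊗₁T ∘T (idT ⁂T swapT)) (⊗₂T ∘T (swapT ⁂T idT)) refl)) ⟩
    P₍ swapC ⁂ id ₎ (P₍ _ ₎ g) ∧ P₍ swapC ⁂ id ₎ (P₍ _ ₎ f)
      ≡⟨ P-∧ _ _ _ ⟨
    P₍ swapC ⁂ id ₎ (g ⊗ f)                       ≡⟨ Γ-⨟ swapC _ ⟨
    σA ⨟ (g ⊗ f)                                  ∎
    where
      open ≡-Reasoning
      Γ₄ = (ι A ⊛ ι B) ⊛ (ι B′ ⊛ ι A′)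

  Γ-⊗-δ : ∀ {A B C} (f : A ⇒ B) → Γ f ⊗ δ {C} ≡ Γ (f ⁂ id)
  Γ-⊗-δ f = trans (cong (Γ f ⊗_) (sym Γ-id)) (Γ-⊗ f id)

  δ-⊗-Γ : ∀ {A B C} (f : A ⇒ B) → δ {C} ⊗ Γ f ≡ Γ (id ⁂ f)
  δ-⊗-Γ f = trans (cong (_⊗ Γ f) (sym Γ-id)) (Γ-⊗ id f)

  pentagon : ∀ {A B C D} → ((αA {A} {B} {C} ⊗ δ {D}) ⨟ αA) ⨟ (δ ⊗ αA) ≡ αA ⨟ αA
  pentagon {A} {B} {C} {D} = begin
    ((αA ⊗ δ) ⨟ αA) ⨟ (δ ⊗ αA)                         ≡⟨ cong₂ (λ h k → (h ⨟ αA) ⨟ k) (Γ-⊗-δ assocC) (δ-⊗-Γ assocC) ⟩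
    (Γ (assocC ⁂ id) ⨟ αA) ⨟ Γ (id ⁂ assocC)           ≡⟨ cong (_⨟ Γ (id ⁂ assocC)) (Γ-∘ _ _) ⟩
    Γ (assocC ∘ (assocC ⁂ id)) ⨟ Γ (id ⁂ assocC)       ≡⟨ Γ-∘ _ _ ⟩
    Γ ((id ⁂ assocC) ∘ assocC ∘ (assocC ⁂ id))         ≡⟨ cong Γ (solve {A = ((ι A ⊛ ι B) ⊛ ι C) ⊛ ι D} {B = ι A ⊛ (ι B ⊛ (ι C ⊛ ι D))}
                                                            ((idT ⁂T assocT) ∘T (assocT ∘T (assocT ⁂T idT))) (assocT ∘T assocT) refl) ⟩
    Γ (assocC ∘ assocC)                                ≡⟨ Γ-∘ _ _ ⟨
    αA ⨟ αA                                            ∎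
    where open ≡-Reasoning

  triangle : ∀ {A B} → αA {A} {I} {B} ⨟ (δ ⊗ λA) ≡ ρA ⊗ δ
  triangle {A} {B} = begin
    αA ⨟ (δ ⊗ λA)                   ≡⟨ cong (αA ⨟_) (δ-⊗-Γ π₂) ⟩
    αA ⨟ Γ (id ⁂ π₂)                ≡⟨ Γ-∘ _ _ ⟩
    Γ ((id ⁂ π₂) ∘ assocC)          ≡⟨ cong Γ (solve {A = (ι A ⊛ ι I) ⊛ ι B} {B = ι A ⊛ ι B}
                                         ((idT ⁂T p₂) ∘T assocT) (p₁ ⁂T idT) refl) ⟩
    Γ (π₁ ⁂ id)                     ≡⟨ Γ-⊗-δ π₁ ⟨
    ρA ⊗ δ                          ∎
    where open ≡-Reasoning

  hexagon : ∀ {A B C} → (αA {A} {B} {C} ⨟ σA) ⨟ αA ≡ ((σA ⊗ δ) ⨟ αA) ⨟ (δ ⊗ σA)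
  hexagon {A} {B} {C} = begin
    (αA ⨟ σA) ⨟ αA                                     ≡⟨ cong (_⨟ αA) (Γ-∘ _ _) ⟩
    Γ (swapC ∘ assocC) ⨟ αA                            ≡⟨ Γ-∘ _ _ ⟩
    Γ (assocC ∘ swapC ∘ assocC)                        ≡⟨ cong Γ (solve {A = (ι A ⊛ ι B) ⊛ ι C} {B = ι B ⊛ (ι C ⊛ ι A)}
                                                            (assocT ∘T (swapT ∘T assocT))
                                                            ((idT ⁂T swapT) ∘T (assocT ∘T (swapT ⁂T idT))) refl) ⟩
    Γ ((id ⁂ swapC) ∘ assocC ∘ (swapC ⁂ id))           ≡⟨ Γ-∘ _ _ ⟨
    Γ (assocC ∘ (swapC ⁂ id)) ⨟ Γ (id ⁂ swapC)         ≡⟨ cong (_⨟ Γ (id ⁂ swapC)) (Γ-∘ _ _) ⟨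
    (Γ (swapC ⁂ id) ⨟ αA) ⨟ Γ (id ⁂ swapC)             ≡⟨ cong₂ (λ h k → (h ⨟ αA) ⨟ k) (Γ-⊗-δ swapC) (δ-⊗-Γ swapC) ⟨
    ((σA ⊗ δ) ⨟ αA) ⨟ (δ ⊗ σA)                         ∎
    where open ≡-Reasoning

  symmetry : ∀ {A B} → σA {A} {B} ⨟ σA ≡ δ
  symmetry = trans (Γ-∘ _ _) (trans (cong Γ swapC∘swapC) Γ-id)

propositionB6 : ∀ {o h p q} (C : CartesianCategory o h) (P : ElementaryExistentialDoctrine C p q) →
    let open AP C P in
    IsSymmetricMonoidalCategory Hom idA _⨟_ _×_ _⊗_ I αA λA ρA σA
propositionB6 C P = record
  { ⨟-assoc  = ⨟-assoc
  ; ⨟-idˡ    = ⨟-identityˡ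
  ; ⨟-idʳ    = ⨟-identityʳ
  ; ⊗-id     = ⊗-δ
  ; ⊗-⨟      = ⊗-⨟
  ; α-iso    = Γ-iso assocC assocC⁻¹ assocC⁻¹∘assocC assocC∘assocC⁻¹
  ; λ-iso    = Γ-iso π₂ ⟨ ! , id ⟩ ⟨!,id⟩∘π₂≡id project₂
  ; ρ-iso    = Γ-iso π₁ ⟨ id , ! ⟩ ⟨id,!⟩∘π₁≡id project₁
  ; σ-iso    = Γ-iso swapC swapC swapC∘swapC swapC∘swapC
  ; α-nat    = α-nat
  ; λ-nat    = λ-nat
  ; ρ-nat    = ρ-nat
  ; σ-nat    = σ-nat
  ; pentagon = pentagon
  ; triangle = triangle
  ; hexagon  = hexagon
  ; symmetry = symmetry
  }
  where
    open AP C P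
    open CartesianMaps C
    open CategoryOfRelations C P
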